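{- Let $v \ge k \ge 2$ be integers, $\lambda$ a positive integer, $V=\mathbb{F}_2^v$, and let $\mathcal{B}$ be a set of $k$-dimensional subspaces of $V$ such that every $2$-dimensional subspace of $V$ is contained in exactly $\lambda$ members of $\mathcal{B}$ (i.e. $(V,\mathcal{B})$ is a simple $2$-$(v,k,\lambda)_2$ subspace design). For $B\in\mathcal{B}$ let $\mathcal{F}_B=\{x+B : x\in V\}$ be the set of the $2^{v-k}$ cosets (affine flats) of $B$ in $V$. Then $\left(V, \bigcup_{B\in\mathcal{B}}\mathcal{F}_B\right)$, whose point set consists of the $2^v$ vectors of $V$ and whose blocks are these flats (each of size $2^k$), is a combinatorial $3$-$(2^v,2^k,\lambda)$ design, i.e. every $3$-element subset of $V$ is contained in exactly $\lambda$ of these blocks.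
   Context: A combinatorial $t$-$(v,k,\lambda)$ design on a finite set $X$ of size $v$ is a collection of $k$-element subsets (blocks) of $X$ such that every $t$-element subset of $X$ is contained in exactly $\lambda$ blocks. A $t$-$(v,k,\lambda)_q$ subspace design on $V=\mathbb{F}_q^v$ is a collection $\mathcal{B}$ of $k$-dimensional subspaces of $V$ such that every $t$-dimensional subspace of $V$ is contained in exactly $\lambda$ members of $\mathcal{B}$; it is simple if $\mathcal{B}$ is a set (no repeated blocks), as assumed throughout the paper. -}

module Defs where

open import Data.Nat using (ℕ; zero; suc)
open import Data.Bool using (Bool; true; false; _xor_)
open import Data.Vec using (Vec; []; _∷_; zipWith; replicate)
open import Data.List using (List; length)
open import Data.List.Relation.Unary.All using (All)
open import Data.List.Relation.Unary.Any using (Any)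
open import Data.List.Relation.Unary.AllPairs using (AllPairs)
open import Data.Product using (Σ; _×_; ∃)
open import Relation.Binary.PropositionalEquality using (_≡_)
open import Relation.Nullary using (¬_)

-- Points of V = F₂^v : bit vectors (Bool ≅ F₂, xor = addition).
Pt : ℕ → Set
Pt v = Vec Bool v

_⊕_ : ∀ {v} → Pt v → Pt v → Pt v
_⊕_ = zipWith _xor_

𝟎 : ∀ {v} → Pt v
𝟎 = replicate _ false

Sub : ℕ → Set
Sub v = Pt v → Bool

_≐_ : ∀ {v} → Sub v → Sub v → Set
S ≐ T = ∀ x → S x ≡ T x

_⊆_ : ∀ {v} → Sub v → Sub v → Set
T ⊆ S = ∀ x → T x ≡ true → S x ≡ true

lincomb : ∀ {v k} → Vec Bool k → Vec (Pt v) k → Pt v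
lincomb [] [] = 𝟎
lincomb (false ∷ c) (b ∷ bs) = lincomb c bs
lincomb (true ∷ c) (b ∷ bs) = b ⊕ lincomb c bs

LinIndep : ∀ {v k} → Vec (Pt v) k → Set
LinIndep {k = k} b = ∀ c → lincomb c b ≡ 𝟎 → c ≡ replicate k false

IsSubspaceDim : ∀ {v} → ℕ → Sub v → Set
IsSubspaceDim {v} k S =
  Σ (Vec (Pt v) k) λ b → LinIndep b ×
    (∀ x → (S x ≡ true → ∃ λ c → lincomb c b ≡ x) × ((∃ λ c → lincomb c b ≡ x) → S x ≡ true))

_∈ₛ_ : ∀ {v} → Sub v → List (Sub v) → Set
S ∈ₛ L = Any (λ T → S ≐ T) L

-- The collection of subsets (up to ≐) satisfying P has exactly n elements:
-- there is a duplicate-free list of exactly the subsets satisfying P, of length n.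
HasExactly : ∀ {v} → (Sub v → Set) → ℕ → Set
HasExactly {v} P n = Σ (List (Sub v)) λ L →
  (length L ≡ n) × All P L × AllPairs (λ S T → ¬ (S ≐ T)) L × (∀ S → P S → S ∈ₛ L)

IsSubspaceDesign2 : (v k lam : ℕ) → List (Sub v) → Set
IsSubspaceDesign2 v k lam ℬ =
  AllPairs (λ S T → ¬ (S ≐ T)) ℬ × All (IsSubspaceDim k) ℬ ×
  (∀ (T : Sub v) → IsSubspaceDim 2 T → HasExactly (λ S → S ∈ₛ ℬ × T ⊆ S) lam)

-- F is a block of the derived design: F = a + B for some B ∈ ℬ, a ∈ V
-- (y ∈ a + B  iff  y + a ∈ B, over F₂).
IsFlatBlock : ∀ {v} → List (Sub v) → Sub v → Set
IsFlatBlock {v} ℬ F = Σ (Sub v) λ B → B ∈ₛ ℬ × (Σ (Pt v) λ a → ∀ y → F y ≡ B (y ⊕ a))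

Is3Design : ∀ {v} → (Sub v → Set) → ℕ → Set
Is3Design {v} IsBlock lam = ∀ (x y z : Pt v) → ¬ (x ≡ y) → ¬ (x ≡ z) → ¬ (y ≡ z) →
  HasExactly (λ F → IsBlock F × F x ≡ true × F y ≡ true × F z ≡ true) lam

module Submission where

-- Three distinct points x, y, z lie in the coset x + B exactly when B contains the
-- 2-dimensional subspace spanned by y + x and z + x, and then x + B is the only coset
-- of B through them. So B ↦ x + B is a bijection from the members of the subspace
-- design through that plane onto the flats through x, y, z, of which there are λ.

open import Defs
open import Data.Nat using (ℕ; _≤_)
open import Data.Bool using (Bool; true; false)
open import Data.Bool.Properties
  using (xor-assoc; xor-comm; xor-identityʳ; xor-same; T-≡; ⇔→≡) renaming (_≟_ to _≟ᵇ_)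
open import Data.Vec using (Vec; []; _∷_)
open import Data.Vec.Properties using (zipWith-assoc; zipWith-comm; zipWith-identityʳ; ≡-dec)
open import Data.Vec.Relation.Unary.All as VecAll using ([]; _∷_)
open import Data.Fin.Subset.Properties using (anySubset?)
open import Data.List using (List; map)
open import Data.List.Properties using (length-map)
import Data.List.Relation.Unary.All as All
import Data.List.Relation.Unary.All.Properties as All
import Data.List.Relation.Unary.Any as Any
import Data.List.Relation.Unary.Any.Properties as Any
import Data.List.Relation.Unary.AllPairs as AllPairs
import Data.List.Relation.Unary.AllPairs.Properties as AllPairs
open import Data.Product using (_×_; ∃; _,_; proj₁; proj₂)
open import Data.Empty using (⊥-elim)
open import Function using (_∘_; _⇔_; mk⇔; Equivalence)
open import Algebra.Structures using (IsCommutativeSemigroup)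
open import Algebra.Bundles using (CommutativeSemigroup)
open import Relation.Binary.PropositionalEquality
open import Relation.Binary.PropositionalEquality.Algebra using (isMagma)
open import Relation.Nullary using (¬_)
open import Relation.Nullary.Decidable using (isYes; toWitness; fromWitness)

⊕-assoc : ∀ {v} (u w t : Pt v) → (u ⊕ w) ⊕ t ≡ u ⊕ (w ⊕ t)
⊕-assoc = zipWith-assoc xor-assoc

⊕-comm : ∀ {v} (u w : Pt v) → u ⊕ w ≡ w ⊕ u
⊕-comm = zipWith-comm xor-comm

⊕-identityʳ : ∀ {v} (u : Pt v) → u ⊕ 𝟎 ≡ u
⊕-identityʳ = zipWith-identityʳ xor-identityʳ

⊕-self : ∀ {v} (u : Pt v) → u ⊕ u ≡ 𝟎
⊕-self []      = refl
⊕-self (b ∷ u) = cong₂ _∷_ (xor-same b) (⊕-self u)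

⊕-isCommutativeSemigroup : ∀ v → IsCommutativeSemigroup _≡_ (_⊕_ {v})
⊕-isCommutativeSemigroup v = record
  { isSemigroup = record { isMagma = isMagma _⊕_ ; assoc = ⊕-assoc }
  ; comm        = ⊕-comm
  }

⊕-commutativeSemigroup : ℕ → CommutativeSemigroup _ _
⊕-commutativeSemigroup v = record { isCommutativeSemigroup = ⊕-isCommutativeSemigroup v }

module _ {v : ℕ} where
  open import Algebra.Properties.CommutativeSemigroup (⊕-commutativeSemigroup v)
    public using (interchange; x∙yz≈y∙xz)

⊕-cancelʳ : ∀ {v} (u w : Pt v) → (u ⊕ w) ⊕ w ≡ u
⊕-cancelʳ u w = begin
  (u ⊕ w) ⊕ w ≡⟨ ⊕-assoc u w w ⟩
  u ⊕ (w ⊕ w) ≡⟨ cong (u ⊕_) (⊕-self w) ⟩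
  u ⊕ 𝟎       ≡⟨ ⊕-identityʳ u ⟩
  u           ∎
  where open ≡-Reasoning

⊕-cancel-middle : ∀ {v} (u w t : Pt v) → (u ⊕ w) ⊕ (t ⊕ w) ≡ u ⊕ t
⊕-cancel-middle u w t = begin
  (u ⊕ w) ⊕ (t ⊕ w) ≡⟨ interchange u w t w ⟩
  (u ⊕ t) ⊕ (w ⊕ w) ≡⟨ cong ((u ⊕ t) ⊕_) (⊕-self w) ⟩
  (u ⊕ t) ⊕ 𝟎       ≡⟨ ⊕-identityʳ (u ⊕ t) ⟩
  u ⊕ t             ∎
  where open ≡-Reasoning

⊕≡𝟎⇒≡ : ∀ {v} {u w : Pt v} → u ⊕ w ≡ 𝟎 → u ≡ w
⊕≡𝟎⇒≡ {u = u} {w} e = begin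
  u           ≡⟨ sym (⊕-cancelʳ u w) ⟩
  (u ⊕ w) ⊕ w ≡⟨ cong (_⊕ w) e ⟩
  𝟎 ⊕ w       ≡⟨ ⊕-comm 𝟎 w ⟩
  w ⊕ 𝟎       ≡⟨ ⊕-identityʳ w ⟩
  w           ∎
  where open ≡-Reasoning

lincomb-⊕ : ∀ {v k} (c d : Vec Bool k) (bs : Vec (Pt v) k) →
            lincomb (c ⊕ d) bs ≡ lincomb c bs ⊕ lincomb d bs
lincomb-⊕ []          []          []       = sym (⊕-identityʳ 𝟎)
lincomb-⊕ (false ∷ c) (false ∷ d) (b ∷ bs) = lincomb-⊕ c d bs
lincomb-⊕ (true ∷ c)  (false ∷ d) (b ∷ bs) =
  trans (cong (b ⊕_) (lincomb-⊕ c d bs)) (sym (⊕-assoc b _ _))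
lincomb-⊕ (false ∷ c) (true ∷ d)  (b ∷ bs) =
  trans (cong (b ⊕_) (lincomb-⊕ c d bs)) (x∙yz≈y∙xz b _ _)
lincomb-⊕ (true ∷ c)  (true ∷ d)  (b ∷ bs) = begin
  lincomb (c ⊕ d) bs                            ≡⟨ lincomb-⊕ c d bs ⟩
  lincomb c bs ⊕ lincomb d bs                   ≡⟨ sym (⊕-cancel-middle _ b _) ⟩
  (lincomb c bs ⊕ b) ⊕ (lincomb d bs ⊕ b)       ≡⟨ cong₂ _⊕_ (⊕-comm _ b) (⊕-comm _ b) ⟩
  (b ⊕ lincomb c bs) ⊕ (b ⊕ lincomb d bs)       ∎
  where open ≡-Reasoning

Closed : ∀ {v} → Sub v → Set
Closed S = ∀ u w → S u ≡ true → S w ≡ true → S (u ⊕ w) ≡ true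

Closed-resp-≐ : ∀ {v} {S T : Sub v} → S ≐ T → Closed T → Closed S
Closed-resp-≐ S≐T closed u w su sw =
  trans (S≐T (u ⊕ w)) (closed u w (trans (sym (S≐T u)) su) (trans (sym (S≐T w)) sw))

subspace⇒closed : ∀ {v k} {S : Sub v} → IsSubspaceDim k S → Closed S
subspace⇒closed (b , _ , spans) u w su sw
  with proj₁ (spans u) su | proj₁ (spans w) sw
... | c , refl | d , refl = proj₂ (spans _) (c ⊕ d , lincomb-⊕ c d b)

lincomb-closed : ∀ {v k} {S : Sub v} {bs : Vec (Pt v) k} → Closed S → S 𝟎 ≡ true →
                 VecAll.All (λ b → S b ≡ true) bs → ∀ c → S (lincomb c bs) ≡ true
lincomb-closed closed s𝟎 []         []          = s𝟎
lincomb-closed closed s𝟎 (sb ∷ sbs) (false ∷ c) = lincomb-closed closed s𝟎 sbs c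
lincomb-closed closed s𝟎 (sb ∷ sbs) (true ∷ c)  =
  closed _ _ sb (lincomb-closed closed s𝟎 sbs c)

-- A coefficient vector over F₂ is a subset of the basis, so the search for one is anySubset?.
span : ∀ {v k} → Vec (Pt v) k → Sub v
span bs x = isYes (anySubset? λ c → ≡-dec _≟ᵇ_ (lincomb c bs) x)

∈span⇔ : ∀ {v k} {bs : Vec (Pt v) k} {x : Pt v} → span bs x ≡ true ⇔ (∃ λ c → lincomb c bs ≡ x)
∈span⇔ = mk⇔ (toWitness ∘ Equivalence.from T-≡) (Equivalence.to T-≡ ∘ fromWitness)

span-isSubspace : ∀ {v k} {bs : Vec (Pt v) k} → LinIndep bs → IsSubspaceDim k (span bs)
span-isSubspace {bs = bs} independent =
  bs , independent , λ x → Equivalence.to ∈span⇔ , Equivalence.from ∈span⇔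

span-⊆ : ∀ {v k} {S : Sub v} {bs : Vec (Pt v) k} → Closed S → S 𝟎 ≡ true →
         VecAll.All (λ b → S b ≡ true) bs → span bs ⊆ S
span-⊆ closed s𝟎 sbs x x∈span with Equivalence.to ∈span⇔ x∈span
... | c , refl = lincomb-closed closed s𝟎 sbs c

translate : ∀ {v} → Sub v → Pt v → Sub v
translate S a y = S (y ⊕ a)

translate-resp-≐ : ∀ {v} {S T : Sub v} {a : Pt v} → S ≐ T → translate S a ≐ translate T a
translate-resp-≐ {a = a} S≐T y = S≐T (y ⊕ a)

translate-cancel : ∀ {v} {S T : Sub v} {a : Pt v} → translate S a ≐ translate T a → S ≐ T
translate-cancel {S = S} {T} {a} Sa≐Ta w =
  subst (λ u → S u ≡ T u) (⊕-cancelʳ w a) (Sa≐Ta (w ⊕ a))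

translate-difference : ∀ {v} {B : Sub v} {a p q : Pt v} → Closed B →
                       translate B a p ≡ true → translate B a q ≡ true → B (p ⊕ q) ≡ true
translate-difference {B = B} {a} {p} {q} closed bp bq =
  subst (λ u → B u ≡ true) (⊕-cancel-middle p a q) (closed _ _ bp bq)

translate-representative : ∀ {v} {B : Sub v} {a x : Pt v} → Closed B →
                           translate B a x ≡ true → translate B a ≐ translate B x
translate-representative {B = B} {a} {x} closed bx w = ⇔→≡ {z = true} (mk⇔
  (λ bw → translate-difference closed bw bx)
  (λ bw → subst (λ u → B u ≡ true)
            (trans (cong ((w ⊕ x) ⊕_) (⊕-comm x a)) (⊕-cancel-middle w x a))
            (closed _ _ bw bx)))

HasExactly-map : ∀ {v n} {P Q : Sub v → Set} (f : Sub v → Sub v) →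
                 (∀ {S T} → S ≐ T → f S ≐ f T) → (∀ {S T} → f S ≐ f T → S ≐ T) →
                 (∀ {S} → P S → Q (f S)) → (∀ {F} → Q F → ∃ λ S → P S × F ≐ f S) →
                 HasExactly P n → HasExactly Q n
HasExactly-map {Q = Q} f f-resp f-cancel P⇒Q Q⇒P (L , |L|≡n , allP , distinct , complete) =
    map f L
  , trans (length-map f L) |L|≡n
  , All.gmap⁺ P⇒Q allP
  , AllPairs.map⁺ (AllPairs.map (_∘ f-cancel) distinct)
  , f-complete
  where
  f-complete : ∀ F → Q F → F ∈ₛ map f L
  f-complete F qF with Q⇒P qF
  ... | S , pS , F≐fS =
    Any.map⁺ (Any.map (λ S≐T w → trans (F≐fS w) (f-resp S≐T w)) (complete S pS))

member-closed : ∀ {v k} {ℬ : List (Sub v)} {B : Sub v} →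
                All.All (IsSubspaceDim k) ℬ → B ∈ₛ ℬ → Closed B
member-closed subspaces B∈ℬ with All.lookupAny subspaces B∈ℬ
... | subspace , B≐ = Closed-resp-≐ B≐ (subspace⇒closed subspace)

module ThreePoints {v : ℕ} {x y z : Pt v} (x≢y : ¬ x ≡ y) (x≢z : ¬ x ≡ z) (y≢z : ¬ y ≡ z)
                   (ℬ : List (Sub v)) where

  directions : Vec (Pt v) 2
  directions = y ⊕ x ∷ z ⊕ x ∷ []

  plane : Sub v
  plane = span directions

  directions-independent : LinIndep directions
  directions-independent (false ∷ false ∷ []) _ = refl
  directions-independent (true ∷ false ∷ []) e =
    ⊥-elim (x≢y (sym (⊕≡𝟎⇒≡ (trans (sym (⊕-identityʳ _)) e))))
  directions-independent (false ∷ true ∷ []) e =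
    ⊥-elim (x≢z (sym (⊕≡𝟎⇒≡ (trans (sym (⊕-identityʳ _)) e))))
  directions-independent (true ∷ true ∷ []) e = ⊥-elim (y≢z (⊕≡𝟎⇒≡ (begin
    y ⊕ z                       ≡⟨ sym (⊕-cancel-middle y x z) ⟩
    (y ⊕ x) ⊕ (z ⊕ x)           ≡⟨ cong ((y ⊕ x) ⊕_) (sym (⊕-identityʳ (z ⊕ x))) ⟩
    (y ⊕ x) ⊕ ((z ⊕ x) ⊕ 𝟎)     ≡⟨ e ⟩
    𝟎                           ∎)))
    where open ≡-Reasoning

  IsMember : Sub v → Set
  IsMember B = B ∈ₛ ℬ × plane ⊆ B

  IsBlock : Sub v → Set
  IsBlock F = IsFlatBlock ℬ F × F x ≡ true × F y ≡ true × F z ≡ true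

  translate-member : ∀ {B} → IsMember B → IsBlock (translate B x)
  translate-member {B} (B∈ℬ , plane⊆B) =
      (B , B∈ℬ , x , λ _ → refl)
    , subst (λ u → B u ≡ true) (sym (⊕-self x)) (plane⊆B 𝟎 (Equivalence.from ∈span⇔ (false ∷ false ∷ [] , refl)))
    , plane⊆B (y ⊕ x) (Equivalence.from ∈span⇔ (true ∷ false ∷ [] , ⊕-identityʳ _))
    , plane⊆B (z ⊕ x) (Equivalence.from ∈span⇔ (false ∷ true ∷ [] , ⊕-identityʳ _))

  block-is-translate : ∀ {k F} → All.All (IsSubspaceDim k) ℬ → IsBlock F →
                       ∃ λ B → IsMember B × F ≐ translate B x
  block-is-translate {F = F} subspaces ((B , B∈ℬ , a , F≐Ba) , Fx , Fy , Fz) =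
    B , (B∈ℬ , plane⊆B) , λ w → trans (F≐Ba w) (translate-representative closed Bx w)
    where
    closed : Closed B
    closed = member-closed subspaces B∈ℬ
    Bx : translate B a x ≡ true
    Bx = trans (sym (F≐Ba x)) Fx
    By : translate B a y ≡ true
    By = trans (sym (F≐Ba y)) Fy
    Bz : translate B a z ≡ true
    Bz = trans (sym (F≐Ba z)) Fz
    plane⊆B : plane ⊆ B
    plane⊆B = span-⊆ closed
      (subst (λ u → B u ≡ true) (⊕-self x) (translate-difference closed Bx Bx))
      (translate-difference closed By Bx ∷ translate-difference closed Bz Bx ∷ [])

theorem2 : (v k lam : ℕ) → 2 ≤ k → k ≤ v → 1 ≤ lam → (ℬ : List (Sub v)) →
    IsSubspaceDesign2 v k lam ℬ → Is3Design (IsFlatBlock ℬ) lam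
-- The bounds on k, v and λ only exclude degenerate designs; the counting needs none of them.
theorem2 v k lam _ _ _ ℬ (_ , subspaces , design) x y z x≢y x≢z y≢z =
  HasExactly-map (λ B → translate B x) translate-resp-≐ translate-cancel
    translate-member (block-is-translate subspaces)
    (design plane (span-isSubspace directions-independent))
  where open ThreePoints x≢y x≢z y≢z ℬ
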